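{- Let $g$ be a good counter on a finite graph $G$. For $i\in\{ -1,0,1\}$ let $A_i$ be the set of vertices $v$ of $G$ with $g(\{v\})=i$, and suppose that $A_1$ and $A_{ -1}$ are both nonempty. Then: $g(\emptyset)=0$; $G$ is connected; $A_1$ and $A_{ -1}$ are both stable sets; and it is not the case that there is both an edge between $A_1$ and $A_0$ and an edge between $A_{ -1}$ and $A_0$.
   Context: All graphs are finite with no loops or parallel edges. For disjoint $X,Y\subseteq V(G)$, $f_G(X,Y)$ is the sum of $(-1)^{|A|}$ over all stable sets $A$ of $G$ with $X\subseteq A$ and $A\cap Y=\emptyset$. A counter on $G$ is either of the functions $f_G$ or $-f_G$. For a counter $g$ and $X\subseteq V(G)$ write $g(X)=g(X,\emptyset)$. A counter $g$ is good if for all disjoint $X,Y\subseteq V(G)$ with $X\cup Y\neq\emptyset$: (i) $|g(X,Y)|\le 1$; and (ii) $|g(X\cup\{u\},Y)-g(X\cup\{v\},Y)|\le 1$ for all $u,v\in V(G)\setminus(X\cup Y)$. (For a good counter, $g(\{v\})\in\{ -1,0,1\}$ for every vertex $v$, so $A_{ -1},A_0,A_1$ partition $V(G)$.) -}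

module Defs where

open import Data.Nat using (ℕ; zero; suc; _≤_; _<_)
open import Data.Fin using (Fin)
open import Data.Fin.Subset using (Subset; _∈_; _∉_; _⊆_; _∪_; _∩_; ⁅_⁆; ⊥; Nonempty; ∣_∣)
open import Data.Bool using (Bool; true; false; _∧_; not; if_then_else_)
open import Data.Vec using (Vec; []; _∷_; allFin)
open import Data.List using (List; []; _∷_; _++_; map; sum; concatMap)
import Data.Vec as Vec
import Data.List as List
open import Data.Integer using (ℤ; +_; -_; _-_; _*_) renaming (∣_∣ to abs)
import Data.Integer as ℤ
open import Data.Product using (Σ; _×_; _,_; ∃; ∃-syntax)
open import Data.Sum using (_⊎_)
open import Relation.Binary.PropositionalEquality using (_≡_)
open import Relation.Nullary using (¬_)

record Graph (n : ℕ) : Set where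
  field
    adj    : Fin n → Fin n → Bool
    sym    : ∀ u v → adj u v ≡ adj v u
    irrefl : ∀ v → adj v v ≡ false
open Graph public

allSubsets : (n : ℕ) → List (Subset n)
allSubsets zero    = [] ∷ []
allSubsets (suc n) = map (false ∷_) (allSubsets n) ++ map (true ∷_) (allSubsets n)

allB : ∀ {n} → (Fin n → Bool) → Bool
allB {n} p = Vec.foldr _ _∧_ true (Vec.map p (allFin n))

memB : ∀ {n} → Fin n → Subset n → Bool
memB v A = Vec.lookup A v

isStable : ∀ {n} → Graph n → Subset n → Bool
isStable G A = allB λ u → allB λ v →
  not (memB u A ∧ memB v A ∧ adj G u v)

subsetB : ∀ {n} → Subset n → Subset n → Bool
subsetB X A = allB λ v → not (memB v X) Data.Bool.∨ memB v A

disjointB : ∀ {n} → Subset n → Subset n → Bool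
disjointB A Y = allB λ v → not (memB v A ∧ memB v Y)

sgn : ℕ → ℤ
sgn zero    = + 1
sgn (suc k) = - sgn k

f : ∀ {n} → Graph n → Subset n → Subset n → ℤ
f {n} G X Y = List.foldr ℤ._+_ (+ 0) (map term (allSubsets n))
  where
  term : Subset n → ℤ
  term A = if isStable G A ∧ subsetB X A ∧ disjointB A Y then sgn ∣ A ∣ else + 0

-- A counter on G is f_G or -f_G: determined by a sign s ∈ {1,-1}.
data Sign : Set where
  plus minus : Sign

counter : ∀ {n} → Sign → Graph n → Subset n → Subset n → ℤ
counter plus  G X Y = f G X Y
counter minus G X Y = - f G X Y

Disjoint : ∀ {n} → Subset n → Subset n → Set
Disjoint X Y = ∀ v → v ∈ X → v ∉ Y

Good : ∀ {n} → (Subset n → Subset n → ℤ) → Set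
Good {n} g = ∀ (X Y : Subset n) → Disjoint X Y → Nonempty (X ∪ Y) →
    (abs (g X Y) ≤ 1)
  × (∀ u v → u ∉ X ∪ Y → v ∉ X ∪ Y →
       abs (g (X ∪ ⁅ u ⁆) Y - g (X ∪ ⁅ v ⁆) Y) ≤ 1)

g₁ : ∀ {n} → (Subset n → Subset n → ℤ) → Subset n → ℤ
g₁ g X = g X ⊥

data Reachable {n} (G : Graph n) : Fin n → Fin n → Set where
  here : ∀ {v} → Reachable G v v
  step : ∀ {u w v} → adj G u w ≡ true → Reachable G w v → Reachable G u v

Connected : ∀ {n} → Graph n → Set
Connected {n} G = (0 < n) × (∀ u v → Reachable G u v)

StableSet : ∀ {n} → Graph n → (Fin n → Set) → Set
StableSet G P = ∀ u v → P u → P v → adj G u v ≡ false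

EdgeBetween : ∀ {n} → Graph n → (Fin n → Set) → (Fin n → Set) → Set
EdgeBetween G P Q = ∃[ u ] ∃[ v ] (P u × Q v × adj G u v ≡ true)

module Submission where

-- The proof rests on three identities for f, proved first by reindexing the sum
-- over all vertex sets:
--   deletion       f(X,Y) = f(X ∪ {v}, Y) + f(X, Y ∪ {v}),
--   neighbourhood  f(X ∪ {v}, Y) = -f(X, Y ∪ N[v])          for v ∉ X ∪ Y,
--   vanishing      f(X,Y) = 0                               if X is not stable,
-- together with f(∅, V(G)) = 1.  From them we derive the product formula
-- f(X,∅) = f(∅,∁V) · f(X,V) for a union of components V avoiding X.  Goodness
-- then confines all relevant values to {-1,0,1}; each claim of the theorem is a
-- short computation with the recurrences followed by a finite case check, and
-- connectivity follows by applying the product formula to the component of a.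

open import Defs hiding (sym)
open import Data.Nat using (ℕ; zero; suc; _≤_; _<_; s≤s; z≤n)
import Data.Nat as ℕ
import Data.Nat.Properties as ℕₚ
open import Data.Fin using (Fin; zero; suc; _≟_)
open Defs.Graph using () renaming (sym to adj-sym)
open import Data.Fin.Subset using (Subset; _∈_; _∉_; _⊆_; _⊃_; _∪_; ∁; ⁅_⁆; ⊥; ⊤; Nonempty; ∣_∣)
open import Data.Fin.Subset.Induction using (⊃-wellFounded; Acc; acc)
open import Data.Fin.Subset.Properties
  using (∉⊥; ∈⊤; ∣⊥∣≡0; _∈?_; x∈⁅x⁆; x∈⁅y⁆⇒x≡y; x∈p∪q⁻; p⊆p∪q; q⊆p∪q;
         ⊆-antisym; p∪∁p≡⊤; x≢y⇒x∉⁅y⁆; ∪-comm; x∈p⇒x∉∁p; x∉p⇒x∈∁p; x∈∁p⇒x∉p; ∪-identityˡ; ∪-commutativeMonoid)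
open import Data.Bool using (Bool; true; false; _∧_; _∨_; not; if_then_else_)
import Data.Bool as Bool
open import Data.Bool.Properties using (not-injective; ¬-not)
open import Data.Vec using ([]; _∷_; tabulate; updateAt; here; there)
import Data.Vec as Vec
open import Data.Vec.Properties
  using ([]=⇒lookup; lookup⇒[]=; tabulate-allFin; lookup∘tabulate; lookup∘updateAt; lookup∘updateAt′)
open import Data.List using (List; []; _∷_; _++_; map)
import Data.List as List
open import Data.List.Properties using (map-∘; map-cong)
open import Data.Integer using (ℤ; +_; -[1+_]; -_; _+_; _-_; _*_) renaming (∣_∣ to abs)
import Data.Integer.Properties as ℤ
open import Algebra.Properties.CommutativeSemigroup ℤ.+-commutativeSemigroup using (interchange)
import Algebra.Properties.CommutativeSemigroup as CommutativeSemigroupProperties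
open import Algebra.Bundles using (CommutativeMonoid)
open import Data.Fin.Properties using (any?)
open import Data.Product using (_×_; _,_; ∃-syntax; proj₁; proj₂)
open import Data.Sum using (inj₁; inj₂; [_,_]′)
open import Function using (_∘_)
open import Function.Bundles using (_⇔_; mk⇔; Equivalence)
open import Relation.Binary.PropositionalEquality
open import Relation.Nullary using (¬_; ¬?; Dec; yes; no; contradiction)
open import Relation.Nullary.Decidable using (_×-dec_)
import Relation.Nullary.Decidable as Dec
open import Data.Empty using () renaming (⊥ to Empty; ⊥-elim to absurd)

open Equivalence using (to; from)

private variable n : ℕ

∈⇒memB : ∀ {v : Fin n} {A} → v ∈ A → memB v A ≡ true
∈⇒memB = []=⇒lookup

memB⇒∈ : ∀ {v : Fin n} {A} → memB v A ≡ true → v ∈ A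
memB⇒∈ = lookup⇒[]= _ _

allB-suc : (p : Fin (suc n) → Bool) → allB p ≡ p zero ∧ allB (p ∘ suc)
allB-suc p = begin
  Vec.foldr _ _∧_ true (Vec.map p (Vec.allFin _))   ≡⟨ cong (Vec.foldr _ _∧_ true) (sym (tabulate-allFin p)) ⟩
  p zero ∧ Vec.foldr _ _∧_ true (tabulate (p ∘ suc)) ≡⟨ cong (λ xs → p zero ∧ Vec.foldr _ _∧_ true xs) (tabulate-allFin (p ∘ suc)) ⟩
  p zero ∧ allB (p ∘ suc)                          ∎
  where open ≡-Reasoning

allB-true : (p : Fin n → Bool) → allB p ≡ true ⇔ (∀ i → p i ≡ true)
allB-true {zero}  p = mk⇔ (λ _ ()) (λ _ → refl)
allB-true {suc n} p rewrite allB-suc p with p zero in p0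
... | false = mk⇔ (λ ()) (λ h → trans (sym p0) (h zero))
... | true  = mk⇔ (λ h → λ { zero → p0 ; (suc i) → to (allB-true (p ∘ suc)) h i })
                  (λ h → from (allB-true (p ∘ suc)) (h ∘ suc))

nand3-true : ∀ a b c → not (a ∧ b ∧ c) ≡ true ⇔ (a ≡ true → b ≡ true → c ≡ false)
nand3-true false b c = mk⇔ (λ _ ()) (λ _ → refl)
nand3-true true false c = mk⇔ (λ _ _ ()) (λ _ → refl)
nand3-true true true c = mk⇔ (λ e _ _ → not-injective e) (λ h → cong not (h refl refl))

implies-true : ∀ a b → not a ∨ b ≡ true ⇔ (a ≡ true → b ≡ true)
implies-true false b = mk⇔ (λ _ ()) (λ _ → refl)
implies-true true b = mk⇔ (λ e _ → e) (λ h → h refl)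

nand-true : ∀ a b → not (a ∧ b) ≡ true ⇔ (a ≡ true → b ≡ false)
nand-true false b = mk⇔ (λ _ ()) (λ _ → refl)
nand-true true b = mk⇔ (λ e _ → not-injective e) (λ h → cong not (h refl))

Independent : Graph n → Subset n → Set
Independent G A = ∀ u w → u ∈ A → w ∈ A → adj G u w ≡ false

Admissible : Graph n → Subset n → Subset n → Subset n → Set
Admissible G X Y A = Independent G A × X ⊆ A × Disjoint A Y

admissibleB : Graph n → Subset n → Subset n → Subset n → Bool
admissibleB G X Y A = isStable G A ∧ subsetB X A ∧ disjointB A Y

isStable⇔ : ∀ (G : Graph n) A → isStable G A ≡ true ⇔ Independent G A
isStable⇔ G A = mk⇔
  (λ h u w u∈A w∈A → to (nand3-true _ _ _)
     (to (allB-true _) (to (allB-true _) h u) w) (∈⇒memB u∈A) (∈⇒memB w∈A))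
  (λ ind → from (allB-true _) λ u → from (allB-true _) λ w →
     from (nand3-true _ _ _) λ u∈A w∈A → ind u w (memB⇒∈ u∈A) (memB⇒∈ w∈A))

subsetB⇔ : (X A : Subset n) → subsetB X A ≡ true ⇔ X ⊆ A
subsetB⇔ X A = mk⇔
  (λ h {v} v∈X → memB⇒∈ (to (implies-true _ _) (to (allB-true _) h v) (∈⇒memB v∈X)))
  (λ X⊆A → from (allB-true _) λ v →
     from (implies-true _ _) λ v∈X → ∈⇒memB (X⊆A {v} (memB⇒∈ v∈X)))

disjointB⇔ : (A Y : Subset n) → disjointB A Y ≡ true ⇔ Disjoint A Y
disjointB⇔ A Y = mk⇔
  (λ h v v∈A v∈Y → contradiction (trans (sym (∈⇒memB v∈Y))
     (to (nand-true _ _) (to (allB-true _) h v) (∈⇒memB v∈A))) λ ())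
  (λ dis → from (allB-true _) λ v → from (nand-true _ _) λ v∈A →
     ¬-not (λ v∈Y → dis v (memB⇒∈ v∈A) (memB⇒∈ v∈Y)))

admissible⇔ : ∀ (G : Graph n) X Y A → admissibleB G X Y A ≡ true ⇔ Admissible G X Y A
admissible⇔ G X Y A = mk⇔
  (λ h → let s , x , d = split h in to (isStable⇔ G A) s , (λ {v} → to (subsetB⇔ X A) x {v}) , to (disjointB⇔ A Y) d)
  (λ (s , x , d) → join (from (isStable⇔ G A) s) (join (from (subsetB⇔ X A) x) (from (disjointB⇔ A Y) d)))
  where
  join : ∀ {a b} → a ≡ true → b ≡ true → a ∧ b ≡ true
  join refl refl = refl
  split : ∀ {a b c} → a ∧ b ∧ c ≡ true → a ≡ true × b ≡ true × c ≡ true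
  split {true} {true} {true} _ = refl , refl , refl

term : Graph n → Subset n → Subset n → Subset n → ℤ
term G X Y A = if admissibleB G X Y A then sgn ∣ A ∣ else + 0

term-admissible : ∀ (G : Graph n) {X Y A} → Admissible G X Y A → term G X Y A ≡ sgn ∣ A ∣
term-admissible G {X} {Y} {A} adm rewrite from (admissible⇔ G X Y A) adm = refl

term-inadmissible : ∀ (G : Graph n) {X Y A} → ¬ Admissible G X Y A → term G X Y A ≡ + 0
term-inadmissible G {X} {Y} {A} ¬adm
  rewrite ¬-not {admissibleB G X Y A} {true} (¬adm ∘ to (admissible⇔ G X Y A)) = refl

admissible? : ∀ (G : Graph n) X Y A → Dec (Admissible G X Y A)
admissible? G X Y A = Dec.map (admissible⇔ G X Y A) (admissibleB G X Y A Bool.≟ true)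

term-cong : ∀ (G : Graph n) {X Y X′ Y′ A} → Admissible G X Y A ⇔ Admissible G X′ Y′ A →
            term G X Y A ≡ term G X′ Y′ A
term-cong G {X} {Y} {A = A} adm⇔ with admissible? G X Y A
... | yes adm = trans (term-admissible G adm) (sym (term-admissible G (to adm⇔ adm)))
... | no ¬adm = trans (term-inadmissible G ¬adm) (sym (term-inadmissible G (¬adm ∘ from adm⇔)))

term-neg : ∀ (G : Graph n) {X Y X′ Y′ A A′} → Admissible G X Y A ⇔ Admissible G X′ Y′ A′ →
           sgn ∣ A ∣ ≡ - sgn ∣ A′ ∣ → term G X Y A ≡ - term G X′ Y′ A′
term-neg G {X} {Y} {A = A} adm⇔ parity with admissible? G X Y A
... | yes adm = trans (term-admissible G adm)
                  (trans parity (cong -_ (sym (term-admissible G (to adm⇔ adm)))))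
... | no ¬adm = trans (term-inadmissible G ¬adm)
                  (cong -_ (sym (term-inadmissible G (¬adm ∘ from adm⇔))))

-- Sums of integer weights over a list, and over all subsets of Fin n.
-- By definition f G X Y is ∑ n (term G X Y); the proofs below use this unfolding.
sumBy : ∀ {A : Set} → (A → ℤ) → List A → ℤ
sumBy F xs = List.foldr _+_ (+ 0) (map F xs)

∑ : (n : ℕ) → (Subset n → ℤ) → ℤ
∑ n F = sumBy F (allSubsets n)

module _ {A : Set} where

  sumBy-cong : ∀ {F H : A → ℤ} → (∀ a → F a ≡ H a) → ∀ xs → sumBy F xs ≡ sumBy H xs
  sumBy-cong F≗H xs = cong (List.foldr _+_ (+ 0)) (map-cong F≗H xs)

  sumBy-++ : ∀ (F : A → ℤ) xs ys → sumBy F (xs ++ ys) ≡ sumBy F xs + sumBy F ys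
  sumBy-++ F []       ys = sym (ℤ.+-identityˡ _)
  sumBy-++ F (x ∷ xs) ys = trans (cong (λ s → F x + s) (sumBy-++ F xs ys)) (sym (ℤ.+-assoc (F x) _ _))

  sumBy-map : ∀ {B : Set} (F : B → ℤ) (h : A → B) xs → sumBy F (map h xs) ≡ sumBy (F ∘ h) xs
  sumBy-map F h xs = cong (List.foldr _+_ (+ 0)) (sym (map-∘ xs))

  sumBy-+ : ∀ (F H : A → ℤ) xs → sumBy (λ a → F a + H a) xs ≡ sumBy F xs + sumBy H xs
  sumBy-+ F H []       = refl
  sumBy-+ F H (x ∷ xs) = trans (cong (λ s → (F x + H x) + s) (sumBy-+ F H xs)) (interchange (F x) (H x) _ _)

  sumBy-neg : ∀ (F : A → ℤ) xs → sumBy (λ a → - F a) xs ≡ - sumBy F xs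
  sumBy-neg F []       = refl
  sumBy-neg F (x ∷ xs) = trans (cong (λ s → - F x + s) (sumBy-neg F xs)) (sym (ℤ.neg-distrib-+ (F x) _))

  sumBy-zero : ∀ (F : A → ℤ) → (∀ a → F a ≡ + 0) → ∀ xs → sumBy F xs ≡ + 0
  sumBy-zero F F≗0 []       = refl
  sumBy-zero F F≗0 (x ∷ xs) = cong₂ _+_ (F≗0 x) (sumBy-zero F F≗0 xs)

∑-suc : ∀ n (F : Subset (suc n) → ℤ) →
        ∑ (suc n) F ≡ ∑ n (F ∘ (false ∷_)) + ∑ n (F ∘ (true ∷_))
∑-suc n F = trans (sumBy-++ F (map (false ∷_) (allSubsets n)) (map (true ∷_) (allSubsets n)))
  (cong₂ _+_ (sumBy-map F _ (allSubsets n)) (sumBy-map F _ (allSubsets n)))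

-- Toggling the membership of one vertex permutes the subsets.
toggle : Fin n → Subset n → Subset n
toggle v A = updateAt A v not

∑-toggle : ∀ n (v : Fin n) (F : Subset n → ℤ) → ∑ n F ≡ ∑ n (F ∘ toggle v)
∑-toggle (suc n) zero    F = trans (∑-suc n F) (trans (ℤ.+-comm (∑ n _) _) (sym (∑-suc n _)))
∑-toggle (suc n) (suc v) F = trans (∑-suc n F)
  (trans (cong₂ _+_ (∑-toggle n v _) (∑-toggle n v _)) (sym (∑-suc n _)))

∑-only-⊥ : ∀ n (F : Subset n → ℤ) → (∀ A → Nonempty A → F A ≡ + 0) → ∑ n F ≡ F ⊥
∑-only-⊥ zero    F _    = ℤ.+-identityʳ (F [])
∑-only-⊥ (suc n) F F≗0 = trans (∑-suc n F) (trans
  (cong₂ _+_ (∑-only-⊥ n _ λ A (v , v∈A) → F≗0 (false ∷ A) (suc v , there v∈A))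
             (sumBy-zero _ (λ A → F≗0 (true ∷ A) (zero , here)) (allSubsets n)))
  (ℤ.+-identityʳ _))

∪⁅⁆⊆ : ∀ {X A : Subset n} {v} → X ⊆ A → v ∈ A → X ∪ ⁅ v ⁆ ⊆ A
∪⁅⁆⊆ {X = X} {v = v} X⊆A v∈A w∈X∪v with x∈p∪q⁻ X ⁅ v ⁆ w∈X∪v
... | inj₁ w∈X = X⊆A w∈X
... | inj₂ w∈v rewrite x∈⁅y⁆⇒x≡y v w∈v = v∈A

∈∪⁅⁆ : ∀ (X : Subset n) v → v ∈ X ∪ ⁅ v ⁆
∈∪⁅⁆ X v = q⊆p∪q X ⁅ v ⁆ (x∈⁅x⁆ v)

disjoint-∪⁅⁆ : ∀ {A Y : Subset n} {v} → Disjoint A Y → v ∉ A → Disjoint A (Y ∪ ⁅ v ⁆)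
disjoint-∪⁅⁆ {Y = Y} {v} dis v∉A w w∈A w∈Y∪v with x∈p∪q⁻ Y ⁅ v ⁆ w∈Y∪v
... | inj₁ w∈Y = dis w w∈A w∈Y
... | inj₂ w∈v rewrite x∈⁅y⁆⇒x≡y v w∈v = v∉A w∈A

disjoint-∪ˡ : ∀ {A Y : Subset n} Z → Disjoint A (Y ∪ Z) → Disjoint A Y
disjoint-∪ˡ Z dis w w∈A w∈Y = dis w w∈A (p⊆p∪q Z w∈Y)

-- Deletion: a vertex v is either in or out of the counted stable set.
term-delete : ∀ (G : Graph n) X Y v A →
              term G X Y A ≡ term G (X ∪ ⁅ v ⁆) Y A + term G X (Y ∪ ⁅ v ⁆) A
term-delete G X Y v A with v ∈? A
... | yes v∈A = begin
  term G X Y A                                          ≡⟨ term-cong G (mk⇔ gain lose) ⟩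
  term G (X ∪ ⁅ v ⁆) Y A                                ≡⟨ ℤ.+-identityʳ _ ⟨
  term G (X ∪ ⁅ v ⁆) Y A + + 0                          ≡⟨ cong (λ t → term G (X ∪ ⁅ v ⁆) Y A + t) (term-inadmissible G blocked) ⟨
  term G (X ∪ ⁅ v ⁆) Y A + term G X (Y ∪ ⁅ v ⁆) A       ∎
  where
  open ≡-Reasoning
  gain : Admissible G X Y A → Admissible G (X ∪ ⁅ v ⁆) Y A
  gain (ind , X⊆A , dis) = ind , ∪⁅⁆⊆ X⊆A v∈A , dis
  lose : Admissible G (X ∪ ⁅ v ⁆) Y A → Admissible G X Y A
  lose (ind , X∪v⊆A , dis) = ind , (λ w∈X → X∪v⊆A (p⊆p∪q ⁅ v ⁆ w∈X)) , dis
  blocked : ¬ Admissible G X (Y ∪ ⁅ v ⁆) A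
  blocked (_ , _ , dis) = dis v v∈A (∈∪⁅⁆ Y v)
... | no v∉A = begin
  term G X Y A                                          ≡⟨ term-cong G (mk⇔ gain lose) ⟩
  term G X (Y ∪ ⁅ v ⁆) A                                ≡⟨ ℤ.+-identityˡ _ ⟨
  + 0 + term G X (Y ∪ ⁅ v ⁆) A                          ≡⟨ cong (λ t → t + term G X (Y ∪ ⁅ v ⁆) A) (term-inadmissible G blocked) ⟨
  term G (X ∪ ⁅ v ⁆) Y A + term G X (Y ∪ ⁅ v ⁆) A       ∎
  where
  open ≡-Reasoning
  gain : Admissible G X Y A → Admissible G X (Y ∪ ⁅ v ⁆) A
  gain (ind , X⊆A , dis) = ind , X⊆A , disjoint-∪⁅⁆ dis v∉A
  lose : Admissible G X (Y ∪ ⁅ v ⁆) A → Admissible G X Y A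
  lose (ind , X⊆A , dis) = ind , X⊆A , disjoint-∪ˡ ⁅ v ⁆ dis
  blocked : ¬ Admissible G (X ∪ ⁅ v ⁆) Y A
  blocked (_ , X∪v⊆A , _) = v∉A (X∪v⊆A (∈∪⁅⁆ X v))

f-delete : ∀ (G : Graph n) X Y v → f G X Y ≡ f G (X ∪ ⁅ v ⁆) Y + f G X (Y ∪ ⁅ v ⁆)
f-delete {n} G X Y v = trans (sumBy-cong (term-delete G X Y v) (allSubsets n))
  (sumBy-+ (term G (X ∪ ⁅ v ⁆) Y) (term G X (Y ∪ ⁅ v ⁆)) (allSubsets n))

f-unstable : ∀ (G : Graph n) X Y {u w} → u ∈ X → w ∈ X → adj G u w ≡ true → f G X Y ≡ + 0
f-unstable {n} G X Y {u} {w} u∈X w∈X uw = sumBy-zero (term G X Y) none (allSubsets n)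
  where
  none : ∀ A → term G X Y A ≡ + 0
  none A = term-inadmissible G {X} {Y} {A} λ (ind , X⊆A , _) →
    contradiction (trans (sym uw) (ind u w (X⊆A u∈X) (X⊆A w∈X))) λ ()

-- When every vertex is forbidden only the empty set is counted.
f-everything-forbidden : ∀ (G : Graph n) → f G ⊥ ⊤ ≡ + 1
f-everything-forbidden {n} G = begin
  ∑ n (term G ⊥ ⊤)   ≡⟨ ∑-only-⊥ n (term G ⊥ ⊤) nonempty-excluded ⟩
  term G ⊥ ⊤ ⊥       ≡⟨ term-admissible G empty-admissible ⟩
  sgn ∣ ⊥ {n} ∣      ≡⟨ cong sgn (∣⊥∣≡0 n) ⟩
  + 1                ∎
  where
  open ≡-Reasoning
  nonempty-excluded : ∀ A → Nonempty A → term G ⊥ ⊤ A ≡ + 0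
  nonempty-excluded A (v , v∈A) = term-inadmissible G {⊥} {⊤} {A} λ (_ , _ , dis) → dis v v∈A ∈⊤
  empty-admissible : Admissible G ⊥ ⊤ ⊥
  empty-admissible = (λ u _ u∈⊥ → contradiction u∈⊥ ∉⊥) , (λ v∈⊥ → v∈⊥) , (λ v v∈⊥ → contradiction v∈⊥ ∉⊥)

nbhd : Graph n → Fin n → Subset n
nbhd G v = tabulate (adj G v)

closedNbhd : Graph n → Fin n → Subset n
closedNbhd G v = ⁅ v ⁆ ∪ nbhd G v

∈nbhd : ∀ (G : Graph n) {v w} → adj G v w ≡ true → w ∈ nbhd G v
∈nbhd G {v} {w} vw = memB⇒∈ (trans (lookup∘tabulate (adj G v) w) vw)

nbhd-adj : ∀ (G : Graph n) {v w} → w ∈ nbhd G v → adj G v w ≡ true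
nbhd-adj G {v} {w} w∈N = trans (sym (lookup∘tabulate (adj G v) w)) (∈⇒memB w∈N)

toggle-adds : ∀ {v : Fin n} {A} → v ∉ A → v ∈ toggle v A
toggle-adds {v = v} {A} v∉A =
  memB⇒∈ (trans (lookup∘updateAt v A) (cong not (¬-not (v∉A ∘ memB⇒∈))))

toggle-removes : ∀ {v : Fin n} {A} → v ∈ A → v ∉ toggle v A
toggle-removes {v = v} {A} v∈A v∈A′ with trans (sym (∈⇒memB v∈A′))
  (trans (lookup∘updateAt v A) (cong not (∈⇒memB v∈A)))
... | ()

toggle-keeps : ∀ {v w : Fin n} {A} → w ≢ v → w ∈ A → w ∈ toggle v A
toggle-keeps {v = v} {w} {A} w≢v w∈A = memB⇒∈ (trans (lookup∘updateAt′ w v w≢v A) (∈⇒memB w∈A))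

toggle-keeps⁻ : ∀ {v w : Fin n} {A} → w ≢ v → w ∈ toggle v A → w ∈ A
toggle-keeps⁻ {v = v} {w} {A} w≢v w∈A′ = memB⇒∈ (trans (sym (lookup∘updateAt′ w v w≢v A)) (∈⇒memB w∈A′))

∣toggle∣ : ∀ {v : Fin n} {A} → v ∈ A → ∣ A ∣ ≡ suc ∣ toggle v A ∣
∣toggle∣ here = refl
∣toggle∣ {A = true ∷ A}  (there v∈A) = cong suc (∣toggle∣ v∈A)
∣toggle∣ {A = false ∷ A} (there v∈A) = ∣toggle∣ v∈A

-- Removing v from stable sets containing v: for v ∉ X ∪ Y, stable sets containing
-- X ∪ {v} and avoiding Y correspond to stable sets containing X and avoiding Y ∪ N[v].
term-nbhd : ∀ (G : Graph n) X Y v → v ∉ X → v ∉ Y → ∀ A →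
            term G (X ∪ ⁅ v ⁆) Y A ≡ - term G X (Y ∪ closedNbhd G v) (toggle v A)
term-nbhd G X Y v v∉X v∉Y A with v ∈? A
... | yes v∈A = term-neg G (mk⇔ remove restore) (cong sgn (∣toggle∣ v∈A))
  where
  A′ = toggle v A
  Y′ = Y ∪ closedNbhd G v

  shrink : ∀ {w} → w ∈ A′ → w ∈ A
  shrink {w} w∈A′ with w ≟ v
  ... | yes refl = v∈A
  ... | no w≢v   = toggle-keeps⁻ w≢v w∈A′

  ≢v : ∀ {w} → w ∈ A′ → w ≢ v
  ≢v w∈A′ refl = toggle-removes v∈A w∈A′

  remove : Admissible G (X ∪ ⁅ v ⁆) Y A → Admissible G X Y′ A′
  remove (ind , X∪v⊆A , dis) = ind′ , X⊆A′ , dis′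
    where
    ind′ : Independent G A′
    ind′ u w u∈A′ w∈A′ = ind u w (shrink u∈A′) (shrink w∈A′)
    X⊆A′ : X ⊆ A′
    X⊆A′ w∈X = toggle-keeps (λ { refl → v∉X w∈X }) (X∪v⊆A (p⊆p∪q ⁅ v ⁆ w∈X))
    dis′ : Disjoint A′ Y′
    dis′ w w∈A′ w∈Y′ with x∈p∪q⁻ Y _ w∈Y′
    ... | inj₁ w∈Y = dis w (shrink w∈A′) w∈Y
    ... | inj₂ w∈N[v] with x∈p∪q⁻ ⁅ v ⁆ _ w∈N[v]
    ...   | inj₁ w∈v = ≢v w∈A′ (x∈⁅y⁆⇒x≡y v w∈v)
    ...   | inj₂ w∈N = contradiction (trans (sym (nbhd-adj G w∈N)) (ind v w v∈A (shrink w∈A′))) λ ()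

  restore : Admissible G X Y′ A′ → Admissible G (X ∪ ⁅ v ⁆) Y A
  restore (ind′ , X⊆A′ , dis′) = ind , ∪⁅⁆⊆ (shrink ∘ X⊆A′) v∈A , dis
    where
    grow : ∀ {w} → w ∈ A → w ≢ v → w ∈ A′
    grow w∈A w≢v = toggle-keeps w≢v w∈A
    non-nbr : ∀ {w} → w ∈ A′ → adj G v w ≡ false
    non-nbr {w} w∈A′ = ¬-not λ vw → dis′ w w∈A′ (q⊆p∪q Y _ (q⊆p∪q ⁅ v ⁆ _ (∈nbhd G vw)))
    ind : Independent G A
    ind u w u∈A w∈A with u ≟ v | w ≟ v
    ... | yes refl | yes refl = irrefl G v
    ... | yes refl | no w≢v   = non-nbr (grow w∈A w≢v)
    ... | no u≢v   | yes refl = trans (adj-sym G u v) (non-nbr (grow u∈A u≢v))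
    ... | no u≢v   | no w≢v   = ind′ u w (grow u∈A u≢v) (grow w∈A w≢v)
    dis : Disjoint A Y
    dis w w∈A w∈Y with w ≟ v
    ... | yes refl = v∉Y w∈Y
    ... | no w≢v   = dis′ w (grow w∈A w≢v) (p⊆p∪q _ w∈Y)
... | no v∉A = trans (term-inadmissible G {X ∪ ⁅ v ⁆} {Y} {A} lacks-v)
                     (cong -_ (sym (term-inadmissible G {X} {Y ∪ closedNbhd G v} {toggle v A} hits-v)))
  where
  lacks-v : ¬ Admissible G (X ∪ ⁅ v ⁆) Y A
  lacks-v (_ , X∪v⊆A , _) = v∉A (X∪v⊆A (∈∪⁅⁆ X v))
  hits-v : ¬ Admissible G X (Y ∪ closedNbhd G v) (toggle v A)
  hits-v (_ , _ , dis) = dis v (toggle-adds v∉A) (q⊆p∪q Y _ (p⊆p∪q (nbhd G v) (x∈⁅x⁆ v)))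

f-nbhd : ∀ (G : Graph n) X Y v → v ∉ X → v ∉ Y →
         f G (X ∪ ⁅ v ⁆) Y ≡ - f G X (Y ∪ closedNbhd G v)
f-nbhd {n} G X Y v v∉X v∉Y = begin
  f G (X ∪ ⁅ v ⁆) Y                           ≡⟨ sumBy-cong (term-nbhd G X Y v v∉X v∉Y) (allSubsets n) ⟩
  ∑ n (λ A → - term G X Y′ (toggle v A))      ≡⟨ sumBy-neg (term G X Y′ ∘ toggle v) (allSubsets n) ⟩
  - ∑ n (term G X Y′ ∘ toggle v)              ≡⟨ cong -_ (∑-toggle n v (term G X Y′)) ⟨
  - f G X Y′                                  ∎
  where
  open ≡-Reasoning
  Y′ = Y ∪ closedNbhd G v

f-expand : ∀ (G : Graph n) X Y v → v ∉ X → v ∉ Y →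
           f G X Y ≡ - f G X (Y ∪ closedNbhd G v) + f G X (Y ∪ ⁅ v ⁆)
f-expand G X Y v v∉X v∉Y =
  trans (f-delete G X Y v) (cong (_+ f G X (Y ∪ ⁅ v ⁆)) (f-nbhd G X Y v v∉X v∉Y))

neg-*-+ : ∀ a b c → - (a * c) + b * c ≡ (- a + b) * c
neg-*-+ a b c = trans (cong (_+ b * c) (ℤ.neg-distribˡ-* a c)) (sym (ℤ.*-distribʳ-+ c (- a) b))

-- A vertex set is closed when no edge leaves it, i.e. it is a union of components.
Closed : Graph n → Subset n → Set
Closed G V = ∀ u w → u ∈ V → adj G u w ≡ true → w ∈ V

∪-⊆ : ∀ {Y S V : Subset n} → Y ⊆ V → S ⊆ V → Y ∪ S ⊆ V
∪-⊆ {Y = Y} {S} Y⊆V S⊆V w∈Y∪S = [ Y⊆V , S⊆V ]′ (x∈p∪q⁻ Y S w∈Y∪S)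

∪-swapʳ : ∀ (Y S C : Subset n) → (Y ∪ S) ∪ C ≡ (Y ∪ C) ∪ S
∪-swapʳ {n} = CommutativeSemigroupProperties.xy∙z≈xz∙y
  (CommutativeMonoid.commutativeSemigroup (∪-commutativeMonoid n))

-- Product formula: if V is closed and X avoids V then, for every Y ⊆ V,
--   f(X,Y) = f(∅, Y ∪ ∁V) · f(X,V),
-- i.e. stable sets split into a part inside V and a part outside V.
-- Induction on Y ordered by ⊃, using the deletion and neighbourhood recurrences
-- at a vertex v ∈ V ∖ Y on both sides; closedness keeps N[v] inside V.
module _ (G : Graph n) {V : Subset n} (closed : Closed G V) {X : Subset n} (X∩V=∅ : Disjoint X V) where

  private
    C = ∁ V
    F = f G X V

  fills : ∀ {Y} → Y ⊆ V → ¬ (∃[ v ] (v ∈ V × v ∉ Y)) → Y ≡ V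
  fills {Y} Y⊆V none = ⊆-antisym Y⊆V V⊆Y
    where
    V⊆Y : V ⊆ Y
    V⊆Y {v} v∈V with v ∈? Y
    ... | yes v∈Y = v∈Y
    ... | no v∉Y  = contradiction (v , v∈V , v∉Y) none

  product-from : ∀ Y → Acc _⊃_ Y → Y ⊆ V → f G X Y ≡ f G ⊥ (Y ∪ C) * F
  product-from Y (acc smaller) Y⊆V with any? (λ v → (v ∈? V) ×-dec ¬? (v ∈? Y))
  ... | no none rewrite fills Y⊆V none | p∪∁p≡⊤ V | f-everything-forbidden G = sym (ℤ.*-identityˡ F)
  ... | yes (v , v∈V , v∉Y) = begin
    f G X Y                                                      ≡⟨ f-expand G X Y v v∉X v∉Y ⟩
    - f G X (Y ∪ N[v]) + f G X (Y ∪ ⁅ v ⁆)                       ≡⟨ cong₂ (λ a b → - a + b) (induct N[v] N[v]⊆V v∈N[v])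
                                                                                           (induct ⁅ v ⁆ ⁅v⁆⊆V (x∈⁅x⁆ v)) ⟩
    - (f G ⊥ ((Y ∪ N[v]) ∪ C) * F) + f G ⊥ ((Y ∪ ⁅ v ⁆) ∪ C) * F ≡⟨ cong₂ (λ a b → - (f G ⊥ a * F) + f G ⊥ b * F)
                                                                          (∪-swapʳ Y N[v] C) (∪-swapʳ Y ⁅ v ⁆ C) ⟩
    - (f G ⊥ (Y∪C ∪ N[v]) * F) + f G ⊥ (Y∪C ∪ ⁅ v ⁆) * F         ≡⟨ neg-*-+ (f G ⊥ (Y∪C ∪ N[v])) (f G ⊥ (Y∪C ∪ ⁅ v ⁆)) F ⟩
    (- f G ⊥ (Y∪C ∪ N[v]) + f G ⊥ (Y∪C ∪ ⁅ v ⁆)) * F             ≡⟨ cong (_* F) (f-expand G ⊥ Y∪C v ∉⊥ v∉Y∪C) ⟨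
    f G ⊥ Y∪C * F                                                ∎
    where
    open ≡-Reasoning
    N[v] = closedNbhd G v
    Y∪C = Y ∪ C
    v∉X : v ∉ X
    v∉X v∈X = X∩V=∅ v v∈X v∈V
    v∉Y∪C : v ∉ Y∪C
    v∉Y∪C v∈Y∪C = [ v∉Y , x∈p⇒x∉∁p v∈V ]′ (x∈p∪q⁻ Y C v∈Y∪C)
    v∈N[v] : v ∈ N[v]
    v∈N[v] = p⊆p∪q (nbhd G v) (x∈⁅x⁆ v)
    ⁅v⁆⊆V : ⁅ v ⁆ ⊆ V
    ⁅v⁆⊆V w∈v = subst (_∈ V) (sym (x∈⁅y⁆⇒x≡y v w∈v)) v∈V
    N[v]⊆V : N[v] ⊆ V
    N[v]⊆V w∈N[v] with x∈p∪q⁻ ⁅ v ⁆ _ w∈N[v]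
    ... | inj₁ w∈v = ⁅v⁆⊆V w∈v
    ... | inj₂ w∈N = closed v _ v∈V (nbhd-adj G w∈N)
    induct : ∀ S → S ⊆ V → v ∈ S → f G X (Y ∪ S) ≡ f G ⊥ ((Y ∪ S) ∪ C) * F
    induct S S⊆V v∈S = product-from (Y ∪ S) (smaller (p⊆p∪q S , v , q⊆p∪q Y S v∈S , v∉Y)) (∪-⊆ Y⊆V S⊆V)

  product : f G X ⊥ ≡ f G ⊥ C * F
  product = trans (product-from ⊥ (⊃-wellFounded ⊥) (λ v∈⊥ → contradiction v∈⊥ ∉⊥))
                  (cong (λ Z → f G ⊥ Z * F) (∪-identityˡ C))

reach-snoc : ∀ {G : Graph n} {u x w} → Reachable G u x → adj G x w ≡ true → Reachable G u w
reach-snoc here        xw = step xw here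
reach-snoc (step e r) xw = step e (reach-snoc r xw)

reach-sym : ∀ {G : Graph n} {u v} → Reachable G u v → Reachable G v u
reach-sym here = here
reach-sym {G = G} (step {u} {w} uw r) = reach-snoc (reach-sym r) (trans (adj-sym G w u) uw)

reach-trans : ∀ {G : Graph n} {u x v} → Reachable G u x → Reachable G x v → Reachable G u v
reach-trans here       r′ = r′
reach-trans (step e r) r′ = step e (reach-trans r r′)

component : ∀ (G : Graph n) a →
            ∃[ K ] (a ∈ K × Closed G K × (∀ w → w ∈ K → Reachable G a w))
component G a = grow ⁅ a ⁆ (⊃-wellFounded _) (x∈⁅x⁆ a)
  (λ w w∈a → subst (Reachable G a) (sym (x∈⁅y⁆⇒x≡y a w∈a)) here)
  where
  grow : ∀ S → Acc _⊃_ S → a ∈ S → (∀ w → w ∈ S → Reachable G a w) →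
         ∃[ K ] (a ∈ K × Closed G K × (∀ w → w ∈ K → Reachable G a w))
  grow S (acc bigger) a∈S reach
    with any? (λ u → any? (λ w → (u ∈? S) ×-dec ¬? (w ∈? S) ×-dec (adj G u w Bool.≟ true)))
  ... | no none = S , a∈S , closed , reach
    where
    closed : Closed G S
    closed u w u∈S uw with w ∈? S
    ... | yes w∈S = w∈S
    ... | no w∉S  = contradiction (u , w , u∈S , w∉S , uw) none
  ... | yes (u , w , u∈S , w∉S , uw) =
    grow (S ∪ ⁅ w ⁆) (bigger (p⊆p∪q ⁅ w ⁆ , w , ∈∪⁅⁆ S w , w∉S)) (p⊆p∪q ⁅ w ⁆ a∈S) reach′
    where
    reach′ : ∀ x → x ∈ S ∪ ⁅ w ⁆ → Reachable G a x
    reach′ x x∈S∪w with x∈p∪q⁻ S ⁅ w ⁆ x∈S∪w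
    ... | inj₁ x∈S = reach x x∈S
    ... | inj₂ x∈w = subst (Reachable G a) (sym (x∈⁅y⁆⇒x≡y w x∈w)) (reach-snoc (reach u u∈S) uw)

∁-closed : ∀ (G : Graph n) {K} → Closed G K → Closed G (∁ K)
∁-closed G closed u w u∈∁K uw =
  x∉p⇒x∈∁p λ w∈K → x∈∁p⇒x∉p u∈∁K (closed w u w∈K (trans (adj-sym G w u) uw))

counter-delete : ∀ s (G : Graph n) X Y v →
  counter s G X Y ≡ counter s G (X ∪ ⁅ v ⁆) Y + counter s G X (Y ∪ ⁅ v ⁆)
counter-delete plus  G X Y v = f-delete G X Y v
counter-delete minus G X Y v =
  trans (cong -_ (f-delete G X Y v)) (ℤ.neg-distrib-+ (f G (X ∪ ⁅ v ⁆) Y) (f G X (Y ∪ ⁅ v ⁆)))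

counter-unstable : ∀ s (G : Graph n) X Y {u w} → u ∈ X → w ∈ X → adj G u w ≡ true →
                   counter s G X Y ≡ + 0
counter-unstable plus  G X Y u∈X w∈X uw = f-unstable G X Y u∈X w∈X uw
counter-unstable minus G X Y u∈X w∈X uw = cong -_ (f-unstable G X Y u∈X w∈X uw)

counter-product : ∀ s (G : Graph n) {V} → Closed G V → ∀ {X} → Disjoint X V →
                  counter s G X ⊥ ≡ f G ⊥ (∁ V) * counter s G X V
counter-product plus  G closed X∩V=∅ = product G closed X∩V=∅
counter-product minus G {V} closed {X} X∩V=∅ =
  trans (cong -_ (product G closed X∩V=∅)) (ℤ.neg-distribʳ-* (f G ⊥ (∁ V)) (f G X V))

counter-vanishes : ∀ s (G : Graph n) X Y → counter s G X Y ≡ + 0 → f G X Y ≡ + 0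
counter-vanishes plus  G X Y g≡0 = g≡0
counter-vanishes minus G X Y g≡0 = trans (sym (ℤ.neg-involutive _)) (cong -_ g≡0)

data Trit : ℤ → Set where
  is-1 : Trit -[1+ 0 ]
  is0  : Trit (+ 0)
  is+1 : Trit (+ 1)

trit : ∀ t → abs t ≤ 1 → Trit t
trit (+ 0)             _         = is0
trit (+ 1)             _         = is+1
trit (+ suc (suc _))   (s≤s ())
trit -[1+ 0 ]          _         = is-1
trit -[1+ suc _ ]      (s≤s ())

data Unit : ℤ → Set where
  is-1 : Unit -[1+ 0 ]
  is+1 : Unit (+ 1)

solve-for : ∀ {a} b c → a ≡ b + c → c ≡ - b + a
solve-for b c refl = begin
  c                ≡⟨ ℤ.+-identityˡ c ⟨
  + 0 + c          ≡⟨ cong (_+ c) (ℤ.+-inverseˡ b) ⟨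
  (- b + b) + c    ≡⟨ ℤ.+-assoc (- b) b c ⟩
  - b + (b + c)    ∎
  where open ≡-Reasoning

units-apart : ∀ p x y → p * x ≡ + 1 → p * y ≡ -[1+ 0 ] → abs (x - y) ≡ 2
units-apart p x y px≡1 py≡-1 = begin
  abs (x - y)                   ≡⟨ ℕₚ.*-identityˡ _ ⟨
  1 ℕ.* abs (x - y)             ≡⟨ cong (ℕ._* abs (x - y)) ∣p∣≡1 ⟨
  abs p ℕ.* abs (x - y)         ≡⟨ ℤ.abs-* p (x - y) ⟨
  abs (p * (x - y))             ≡⟨ cong abs p[x-y]≡2 ⟩
  2                             ∎
  where
  open ≡-Reasoning
  ∣p∣≡1 : abs p ≡ 1
  ∣p∣≡1 = ℕₚ.m*n≡1⇒m≡1 (abs p) (abs x) (trans (sym (ℤ.abs-* p x)) (cong abs px≡1))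
  p[x-y]≡2 : p * (x - y) ≡ + 2
  p[x-y]≡2 = begin
    p * (x + - y)       ≡⟨ ℤ.*-distribˡ-+ p x (- y) ⟩
    p * x + p * - y     ≡⟨ cong (λ t → p * x + t) (ℤ.neg-distribʳ-* p y) ⟨
    p * x + - (p * y)   ≡⟨ cong₂ (λ a b → a + - b) px≡1 py≡-1 ⟩
    + 2                 ∎

adjacent-distinct : ∀ (G : Graph n) {x y} → adj G x y ≡ true → x ≢ y
adjacent-distinct G {x} xy refl with trans (sym xy) (irrefl G x)
... | ()

∉pair : ∀ {u a b : Fin n} → u ≢ a → u ≢ b → u ∉ ⁅ a ⁆ ∪ ⁅ b ⁆
∉pair {a = a} {b} u≢a u≢b u∈ab = [ x≢y⇒x∉⁅y⁆ u≢a , x≢y⇒x∉⁅y⁆ u≢b ]′ (x∈p∪q⁻ ⁅ a ⁆ ⁅ b ⁆ u∈ab)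

positive : Fin n → 0 < n
positive {suc n} _ = s≤s z≤n

module GoodCounter (G : Graph n) (s : Sign) (good : Good (counter s G)) where

  g : Subset n → Subset n → ℤ
  g = counter s G

  bounded : ∀ X Y → Disjoint X Y → ∀ {w} → w ∈ X ∪ Y → Trit (g X Y)
  bounded X Y dis {w} w∈X∪Y = trit _ (proj₁ (good X Y dis (w , w∈X∪Y)))

  bounded-in : ∀ X {w} → w ∈ X → Trit (g X ⊥)
  bounded-in X w∈X = bounded X ⊥ (λ _ _ → ∉⊥) (p⊆p∪q ⊥ w∈X)

  bounded-out : ∀ Y {w} → w ∈ Y → Trit (g ⊥ Y)
  bounded-out Y w∈Y = bounded ⊥ Y (λ _ v∈⊥ → contradiction v∈⊥ ∉⊥) (q⊆p∪q ⊥ Y w∈Y)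

  close : ∀ Y {w u v} → w ∈ Y → u ∉ Y → v ∉ Y → abs (g ⁅ u ⁆ Y - g ⁅ v ⁆ Y) ≤ 1
  close Y {w} {u} {v} w∈Y u∉Y v∉Y =
    subst (_≤ 1) (cong₂ (λ A B → abs (g A Y - g B Y)) (∪-identityˡ ⁅ u ⁆) (∪-identityˡ ⁅ v ⁆))
      (proj₂ (good ⊥ Y (λ _ v∈⊥ → contradiction v∈⊥ ∉⊥) (w , q⊆p∪q ⊥ Y w∈Y)) u v (outside u∉Y) (outside v∉Y))
    where
    outside : ∀ {x} → x ∉ Y → x ∉ ⊥ ∪ Y
    outside x∉Y = x∉Y ∘ subst (_ ∈_) (∪-identityˡ Y)

  delete-in : ∀ X v → g X ⊥ ≡ g (X ∪ ⁅ v ⁆) ⊥ + g X ⁅ v ⁆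
  delete-in X v = trans (counter-delete s G X ⊥ v)
    (cong (λ Y → g (X ∪ ⁅ v ⁆) ⊥ + g X Y) (∪-identityˡ ⁅ v ⁆))

  delete-out : ∀ Y v → g ⊥ Y ≡ g ⁅ v ⁆ Y + g ⊥ (Y ∪ ⁅ v ⁆)
  delete-out Y v = trans (counter-delete s G ⊥ Y v)
    (cong (λ X → g X Y + g ⊥ (Y ∪ ⁅ v ⁆)) (∪-identityˡ ⁅ v ⁆))

  delete-∅ : ∀ v → g ⊥ ⊥ ≡ g ⁅ v ⁆ ⊥ + g ⊥ ⁅ v ⁆
  delete-∅ v = trans (delete-out ⊥ v) (cong (λ Y → g ⁅ v ⁆ ⊥ + g ⊥ Y) (∪-identityˡ ⁅ v ⁆))

  forbid-neighbour : ∀ X {u v} → u ∈ X → adj G u v ≡ true → g X ⊥ ≡ g X ⁅ v ⁆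
  forbid-neighbour X {u} {v} u∈X uv = begin
    g X ⊥                          ≡⟨ delete-in X v ⟩
    g (X ∪ ⁅ v ⁆) ⊥ + g X ⁅ v ⁆    ≡⟨ cong (_+ g X ⁅ v ⁆) (counter-unstable s G _ ⊥ (p⊆p∪q ⁅ v ⁆ u∈X) (∈∪⁅⁆ X v) uv) ⟩
    + 0 + g X ⁅ v ⁆                ≡⟨ ℤ.+-identityˡ _ ⟩
    g X ⁅ v ⁆                      ∎
    where open ≡-Reasoning

  values-differ : ∀ {u v i j} → g ⁅ u ⁆ ⊥ ≡ i → g ⁅ v ⁆ ⊥ ≡ j → i ≢ j → u ≢ v
  values-differ gu gv i≢j refl = i≢j (trans (sym gu) gv)

  -- Claim 1: if both values 1 and -1 occur then g(∅) = 0, since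
  -- g(∅) = 1 + g(∅,{a}) = -1 + g(∅,{b}) with both correction terms in {-1,0,1}.
  empty-vanishes : ∀ {a b} → g ⁅ a ⁆ ⊥ ≡ + 1 → g ⁅ b ⁆ ⊥ ≡ -[1+ 0 ] → g ⊥ ⊥ ≡ + 0
  empty-vanishes {a} {b} ga gb =
    forced (bounded-out ⁅ a ⁆ (x∈⁅x⁆ a)) (bounded-out ⁅ b ⁆ (x∈⁅x⁆ b))
      (trans (delete-∅ a) (cong (_+ g ⊥ ⁅ a ⁆) ga)) (trans (delete-∅ b) (cong (_+ g ⊥ ⁅ b ⁆) gb))
    where
    forced : ∀ {z t t′} → Trit t → Trit t′ → z ≡ + 1 + t → z ≡ -[1+ 0 ] + t′ → z ≡ + 0
    forced is-1 _    refl _  = refl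
    forced is0  is-1 refl ()
    forced is0  is0  refl ()
    forced is0  is+1 refl ()
    forced is+1 is-1 refl ()
    forced is+1 is0  refl ()
    forced is+1 is+1 refl ()

  -- Adjacent vertices with equal singleton values have value 0 (given g(∅) = 0):
  -- with c = g({u}) = g({u},{w}) one gets 0 = c + g(∅,{w}) = c + (c + t), |t| ≤ 1.
  equal-neighbours : g ⊥ ⊥ ≡ + 0 → ∀ {u w} → adj G u w ≡ true →
                     g ⁅ u ⁆ ⊥ ≡ g ⁅ w ⁆ ⊥ → g ⁅ u ⁆ ⊥ ≡ + 0
  equal-neighbours g∅≡0 {u} {w} uw same =
    forced (bounded-in ⁅ u ⁆ (x∈⁅x⁆ u)) (bounded-out (⁅ w ⁆ ∪ ⁅ u ⁆) (∈∪⁅⁆ ⁅ w ⁆ u))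
      (trans (delete-out ⁅ w ⁆ u) (cong (_+ g ⊥ (⁅ w ⁆ ∪ ⁅ u ⁆)) (sym (forbid-neighbour ⁅ u ⁆ (x∈⁅x⁆ u) uw))))
      (trans (sym g∅≡0) (trans (delete-∅ w) (cong (_+ g ⊥ ⁅ w ⁆) (sym same))))
    where
    forced : ∀ {c t s} → Trit c → Trit t → s ≡ c + t → + 0 ≡ c + s → c ≡ + 0
    forced is0  _    _    _  = refl
    forced is-1 is-1 refl ()
    forced is-1 is0  refl ()
    forced is-1 is+1 refl ()
    forced is+1 is-1 refl ()
    forced is+1 is0  refl ()
    forced is+1 is+1 refl ()

  level-set-stable : g ⊥ ⊥ ≡ + 0 → ∀ {c} → c ≢ + 0 → StableSet G (λ v → g ⁅ v ⁆ ⊥ ≡ c)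
  level-set-stable g∅≡0 c≢0 u w gu gw =
    ¬-not λ uw → c≢0 (trans (sym gu) (equal-neighbours g∅≡0 uw (trans gu (sym gw))))

  -- Across an edge x–y from a vertex of unit value ε, a vertex z ≠ y of value -ε
  -- satisfies g({z,y}) = -ε: comparing g({x},{y}) = ε with g({z},{y}) = -ε - g({z,y}).
  opposite-across-edge : ∀ {x y z ε} → Unit ε → adj G x y ≡ true → z ≢ y →
    g ⁅ x ⁆ ⊥ ≡ ε → g ⁅ z ⁆ ⊥ ≡ - ε → g (⁅ z ⁆ ∪ ⁅ y ⁆) ⊥ ≡ - ε
  opposite-across-edge {x} {y} {z} {ε} unit xy z≢y gx gz =
    pinned unit (bounded-in (⁅ z ⁆ ∪ ⁅ y ⁆) (p⊆p∪q ⁅ y ⁆ (x∈⁅x⁆ z))) gap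
    where
    β = g (⁅ z ⁆ ∪ ⁅ y ⁆) ⊥
    gzy : g ⁅ z ⁆ ⁅ y ⁆ ≡ - β + - ε
    gzy = solve-for β _ (trans (sym gz) (delete-in ⁅ z ⁆ y))
    gxy : g ⁅ x ⁆ ⁅ y ⁆ ≡ ε
    gxy = trans (sym (forbid-neighbour ⁅ x ⁆ (x∈⁅x⁆ x) xy)) gx
    gap : abs (ε - (- β + - ε)) ≤ 1
    gap = subst (_≤ 1) (cong₂ (λ a b → abs (a - b)) gxy gzy)
      (close ⁅ y ⁆ (x∈⁅x⁆ y) (x≢y⇒x∉⁅y⁆ (adjacent-distinct G xy)) (x≢y⇒x∉⁅y⁆ z≢y))
    pinned : ∀ {ε β} → Unit ε → Trit β → abs (ε - (- β + - ε)) ≤ 1 → β ≡ - ε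
    pinned is+1 is-1 _        = refl
    pinned is+1 is0  (s≤s ())
    pinned is+1 is+1 (s≤s ())
    pinned is-1 is+1 _        = refl
    pinned is-1 is-1 (s≤s ())
    pinned is-1 is0  (s≤s ())

  -- For an edge y–x with g({y}) = 0: g({y}, {x,z}) = -g({z,y}), by deleting z from
  -- g({y},{x}) = g({y}) = 0 and using g({y,z},{x}) = g({y,z}).
  zero-endpoint : ∀ {x y} z → adj G y x ≡ true → g ⁅ y ⁆ ⊥ ≡ + 0 →
                  g ⁅ y ⁆ (⁅ x ⁆ ∪ ⁅ z ⁆) ≡ - g (⁅ z ⁆ ∪ ⁅ y ⁆) ⊥
  zero-endpoint {x} {y} z yx gy = begin
    g ⁅ y ⁆ (⁅ x ⁆ ∪ ⁅ z ⁆)          ≡⟨ solve-for (g (⁅ y ⁆ ∪ ⁅ z ⁆) ⁅ x ⁆) _ split ⟩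
    - g (⁅ y ⁆ ∪ ⁅ z ⁆) ⁅ x ⁆ + + 0  ≡⟨ ℤ.+-identityʳ _ ⟩
    - g (⁅ y ⁆ ∪ ⁅ z ⁆) ⁅ x ⁆        ≡⟨ cong -_ (forbid-neighbour (⁅ y ⁆ ∪ ⁅ z ⁆) (p⊆p∪q ⁅ z ⁆ (x∈⁅x⁆ y)) yx) ⟨
    - g (⁅ y ⁆ ∪ ⁅ z ⁆) ⊥            ≡⟨ cong (λ A → - g A ⊥) (∪-comm ⁅ y ⁆ ⁅ z ⁆) ⟩
    - g (⁅ z ⁆ ∪ ⁅ y ⁆) ⊥            ∎
    where
    open ≡-Reasoning
    split : + 0 ≡ g (⁅ y ⁆ ∪ ⁅ z ⁆) ⁅ x ⁆ + g ⁅ y ⁆ (⁅ x ⁆ ∪ ⁅ z ⁆)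
    split = trans (sym gy) (trans (forbid-neighbour ⁅ y ⁆ (x∈⁅x⁆ y) yx) (counter-delete s G ⁅ y ⁆ ⁅ x ⁆ z))

  -- Claim 5: edges a–c and b–d with values 1, 0, -1, 0 cannot coexist, since
  -- g({c},{a,b}) = 1 and g({d},{a,b}) = -1 would violate goodness (ii).
  no-edges-to-zero-from-both : ∀ {a c b d} →
    g ⁅ a ⁆ ⊥ ≡ + 1 → g ⁅ c ⁆ ⊥ ≡ + 0 → adj G a c ≡ true →
    g ⁅ b ⁆ ⊥ ≡ -[1+ 0 ] → g ⁅ d ⁆ ⊥ ≡ + 0 → adj G b d ≡ true → Empty
  no-edges-to-zero-from-both {a} {c} {b} {d} ga gc ac gb gd bd =
    two-apart (subst (_≤ 1) (cong₂ (λ p q → abs (p - q)) gcY gdY) (close Y (p⊆p∪q ⁅ b ⁆ (x∈⁅x⁆ a)) c∉Y d∉Y))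
    where
    two-apart : ¬ (abs (+ 1 - -[1+ 0 ]) ≤ 1)
    two-apart (s≤s ())
    Y = ⁅ a ⁆ ∪ ⁅ b ⁆
    c∉Y : c ∉ Y
    c∉Y = ∉pair (adjacent-distinct G ac ∘ sym) (values-differ gc gb λ ())
    d∉Y : d ∉ Y
    d∉Y = ∉pair (values-differ gd ga λ ()) (adjacent-distinct G bd ∘ sym)
    gcY : g ⁅ c ⁆ Y ≡ + 1
    gcY = trans (zero-endpoint b (trans (adj-sym G c a) ac) gc)
                (cong -_ (opposite-across-edge is+1 ac (values-differ gb gc λ ()) ga gb))
    gdY : g ⁅ d ⁆ Y ≡ -[1+ 0 ]
    gdY = trans (cong (g ⁅ d ⁆) (∪-comm ⁅ a ⁆ ⁅ b ⁆))
          (trans (zero-endpoint a (trans (adj-sym G d b) bd) gd)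
                 (cong -_ (opposite-across-edge is-1 bd (values-differ ga gd λ ()) gb ga)))

  -- A closed set K containing vertices of both values 1 and -1 is everything:
  -- otherwise the product formula for V = ∁K gives g({a}) = p·x, g({b}) = p·y
  -- with |x - y| = 2, against goodness (ii) for Y = ∁K.
  both-signs-inside : ∀ {K a b} → Closed G K → a ∈ K → b ∈ K →
    g ⁅ a ⁆ ⊥ ≡ + 1 → g ⁅ b ⁆ ⊥ ≡ -[1+ 0 ] → ∀ w → w ∈ K
  both-signs-inside {K} {a} {b} closed a∈K b∈K ga gb w with w ∈? K
  ... | yes w∈K = w∈K
  ... | no  w∉K = contradiction (close (∁ K) (x∉p⇒x∈∁p w∉K) (x∈p⇒x∉∁p a∈K) (x∈p⇒x∉∁p b∈K)) too-far
    where
    inside : ∀ {x} → x ∈ K → Disjoint ⁅ x ⁆ (∁ K)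
    inside {x} x∈K v v∈x = subst (_∉ ∁ K) (sym (x∈⁅y⁆⇒x≡y x v∈x)) (x∈p⇒x∉∁p x∈K)
    factor : ∀ {x} → x ∈ K → g ⁅ x ⁆ ⊥ ≡ f G ⊥ (∁ (∁ K)) * g ⁅ x ⁆ (∁ K)
    factor x∈K = counter-product s G (∁-closed G closed) (inside x∈K)
    too-far : ¬ (abs (g ⁅ a ⁆ (∁ K) - g ⁅ b ⁆ (∁ K)) ≤ 1)
    too-far ≤1 with subst (_≤ 1) (units-apart (f G ⊥ (∁ (∁ K))) (g ⁅ a ⁆ (∁ K)) (g ⁅ b ⁆ (∁ K)) (trans (sym (factor a∈K)) ga) (trans (sym (factor b∈K)) gb)) ≤1
    ... | s≤s ()

  -- With g(∅) = 0 a closed K cannot separate a vertex of value 1 from one of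
  -- value -1: the product formula makes g(∅) = ±q·p vanish while g({a}) = q·x and
  -- g({b}) = p·y are nonzero, where p, q count stable sets inside K and ∁K.
  no-separation : g ⊥ ⊥ ≡ + 0 → ∀ {K a b} → Closed G K → a ∈ K → b ∉ K →
    g ⁅ a ⁆ ⊥ ≡ + 1 → g ⁅ b ⁆ ⊥ ≡ -[1+ 0 ] → Empty
  no-separation g∅≡0 {K} {a} {b} closed a∈K b∉K ga gb
    with ℤ.i*j≡0⇒i≡0∨j≡0 (f G ⊥ (∁ (∁ K)))
           (trans (sym (counter-product s G (∁-closed G closed) {⊥} (λ _ v∈⊥ → contradiction v∈⊥ ∉⊥))) g∅≡0)
  ... | inj₁ q≡0 = contradiction (trans (sym ga) (trans (counter-product s G (∁-closed G closed) a-inside)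
                                    (cong (_* g ⁅ a ⁆ (∁ K)) q≡0))) λ ()
    where
    a-inside : Disjoint ⁅ a ⁆ (∁ K)
    a-inside v v∈a = subst (_∉ ∁ K) (sym (x∈⁅y⁆⇒x≡y a v∈a)) (x∈p⇒x∉∁p a∈K)
  ... | inj₂ g∁K≡0 = contradiction (trans (sym gb) (trans (counter-product s G closed b-outside)
                                    (cong (_* g ⁅ b ⁆ K) (counter-vanishes s G ⊥ (∁ K) g∁K≡0)))) λ ()
    where
    b-outside : Disjoint ⁅ b ⁆ K
    b-outside v v∈b = subst (_∉ K) (sym (x∈⁅y⁆⇒x≡y b v∈b)) b∉K

  connected : g ⊥ ⊥ ≡ + 0 → ∀ {a b} → g ⁅ a ⁆ ⊥ ≡ + 1 → g ⁅ b ⁆ ⊥ ≡ -[1+ 0 ] → Connected G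
  connected g∅≡0 {a} {b} ga gb with component G a
  ... | K , a∈K , closed , reach =
    positive a , λ u v → reach-trans (reach-sym (reach u (everything u))) (reach v (everything v))
    where
    everything : ∀ w → w ∈ K
    everything with b ∈? K
    ... | yes b∈K = both-signs-inside closed a∈K b∈K ga gb
    ... | no  b∉K = λ _ → absurd (no-separation g∅≡0 closed a∈K b∉K ga gb)

mainTheorem10 : ∀ {n} (G : Graph n) (s : Sign) →
    Good (counter s G) →
    (∃[ a ] g₁ (counter s G) ⁅ a ⁆ ≡ + 1) →
    (∃[ b ] g₁ (counter s G) ⁅ b ⁆ ≡ -[1+ 0 ]) →
      (g₁ (counter s G) ⊥ ≡ + 0)
    × Connected G
    × StableSet G (λ v → g₁ (counter s G) ⁅ v ⁆ ≡ + 1)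
    × StableSet G (λ v → g₁ (counter s G) ⁅ v ⁆ ≡ -[1+ 0 ])
    × ¬ ( EdgeBetween G (λ v → g₁ (counter s G) ⁅ v ⁆ ≡ + 1)
                        (λ v → g₁ (counter s G) ⁅ v ⁆ ≡ + 0)
        × EdgeBetween G (λ v → g₁ (counter s G) ⁅ v ⁆ ≡ -[1+ 0 ])
                        (λ v → g₁ (counter s G) ⁅ v ⁆ ≡ + 0) )
mainTheorem10 G s good (a , ga) (b , gb) =
    g∅≡0
  , connected g∅≡0 ga gb
  , level-set-stable g∅≡0 (λ ())
  , level-set-stable g∅≡0 (λ ())
  , λ ((_ , _ , ga′ , gc , ac) , (_ , _ , gb′ , gd , bd)) → no-edges-to-zero-from-both ga′ gc ac gb′ gd bd
  where
  open GoodCounter G s good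
  g∅≡0 : g ⊥ ⊥ ≡ + 0
  g∅≡0 = empty-vanishes ga gb
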